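{- Every formula of $\mathcal{P}(\supset)_{\sigma}$ is equivalent to a $\mathcal{P}(\supset)_{\sigma}$ formula with the following property: each occurrence of the form $\alpha\supset\psi$ is either inside a probabilistic statement, in the antecedent of an $\supset$, or $\psi$ is a probabilistic atom.
   Context: $\mathcal{PCO}_\sigma$ is the language over signature $\sigma$ built from $\mathcal{CO}$ literals $Y=y$, $Y\neq y$ and probabilistic atoms $\Pr(\alpha)\geq\epsilon$, $\Pr(\alpha)>\epsilon$, $\Pr(\alpha)\geq\Pr(\beta)$, $\Pr(\alpha)>\Pr(\beta)$ ($\alpha,\beta\in\mathcal{CO}$, $\epsilon\in[0,1]\cap\mathbb Q$), closed under $\land$, global disjunction $\sqcup$, selective implication $\alpha\supset\varphi$ ($\alpha\in\mathcal{CO}$; true in a causal multiteam $T$ iff $\varphi$ is true in the sub-multiteam of assignments satisfying $\alpha$) and interventionist counterfactual $\mathbf X=\mathbf x\,\Box\!\!\rightarrow\varphi$. $\mathcal P(\supset)_\sigma$ is the fragment without $\Box\!\!\rightarrow$. Equivalence means being satisfied by the same causal multiteams of signature $\sigma$. -}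

module Defs where

open import Data.Nat using (ℕ; zero; suc)
open import Data.Fin using (Fin; _≟_)
open import Data.Bool using (Bool; true; false; not; _∧_; _∨_)
open import Data.List using (List; []; _∷_; filter; length)
open import Data.List.Relation.Unary.All using (All)
open import Data.Product using (_×_)
open import Data.Sum using (_⊎_)
open import Data.Integer using (+_)
open import Data.Rational using (ℚ; 0ℚ; 1ℚ; _/_; _≤_; _<_)
open import Relation.Nullary.Decidable using (⌊_⌋)
open import Relation.Binary.PropositionalEquality using (_≡_)
open import Data.Unit using (⊤)
open import Data.Empty using (⊥)

record Signature : Set where
  field
    n   : ℕ
    rng : Fin n → ℕ
open Signature public

module _ (σ : Signature) where

  Var : Set
  Var = Fin (n σ)

  Val : Var → Set
  Val Y = Fin (rng σ Y)

  Assignment : Set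
  Assignment = (Y : Var) → Val Y

  -- A multiteam is a finite multiset of assignments (represented as a
  -- list; the formulas below are insensitive to the order).
  Multiteam : Set
  Multiteam = List Assignment

  -- CO formulas (without □→), flat semantics

  data CO : Set where
    _≐_  : (Y : Var) → Val Y → CO
    _≠_  : (Y : Var) → Val Y → CO
    _∧ᶜ_ : CO → CO → CO
    _∨ᶜ_ : CO → CO → CO
    _⊃ᶜ_ : CO → CO → CO

  evalCO : Assignment → CO → Bool
  evalCO s (Y ≐ y)   = ⌊ s Y ≟ y ⌋
  evalCO s (Y ≠ y)   = not ⌊ s Y ≟ y ⌋
  evalCO s (α ∧ᶜ β)  = evalCO s α ∧ evalCO s β
  evalCO s (α ∨ᶜ β)  = evalCO s α ∨ evalCO s β
  evalCO s (α ⊃ᶜ β)  = not (evalCO s α) ∨ evalCO s β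

  select : CO → Multiteam → Multiteam
  select α T = filter (λ s → evalCO s α ≡? true) T
    where
      open import Data.Bool using () renaming (_≟_ to _≡?_)

  -- probability: k / m, with an irrelevant value for m = 0
  ratio : ℕ → ℕ → ℚ
  ratio k zero    = 0ℚ
  ratio k (suc m) = (+ k) / suc m

  Pr : Multiteam → CO → ℚ
  Pr T α = ratio (length (select α T)) (length T)

  data PF : Set where
    lit≐  : (Y : Var) → Val Y → PF
    lit≠  : (Y : Var) → Val Y → PF
    pr≥   : CO → (ε : ℚ) → 0ℚ ≤ ε → ε ≤ 1ℚ → PF
    pr>   : CO → (ε : ℚ) → 0ℚ ≤ ε → ε ≤ 1ℚ → PF
    pr≥pr : CO → CO → PF
    pr>pr : CO → CO → PF
    _∧ᵖ_  : PF → PF → PF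
    _⊔_   : PF → PF → PF
    _⊃_   : CO → PF → PF

  -- probabilistic atoms are true in the empty multiteam
  _⊨_ : Multiteam → PF → Set
  T ⊨ lit≐ Y y        = All (λ s → s Y ≡ y) T
  T ⊨ lit≠ Y y        = All (λ s → evalCO s (Y ≠ y) ≡ true) T
  T ⊨ pr≥ α ε _ _     = T ≡ [] ⊎ (ε ≤ Pr T α)
  T ⊨ pr> α ε _ _     = T ≡ [] ⊎ (ε < Pr T α)
  T ⊨ pr≥pr α β       = T ≡ [] ⊎ (Pr T β ≤ Pr T α)
  T ⊨ pr>pr α β       = T ≡ [] ⊎ (Pr T β < Pr T α)
  T ⊨ (φ ∧ᵖ ψ)        = (T ⊨ φ) × (T ⊨ ψ)
  T ⊨ (φ ⊔ ψ)         = (T ⊨ φ) ⊎ (T ⊨ ψ)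
  T ⊨ (α ⊃ φ)         = select α T ⊨ φ

  Equivalent : PF → PF → Set
  Equivalent φ ψ = (T : Multiteam) → (T ⊨ φ → T ⊨ ψ) × (T ⊨ ψ → T ⊨ φ)

  IsProbAtom : PF → Set
  IsProbAtom (pr≥ _ _ _ _) = ⊤
  IsProbAtom (pr> _ _ _ _) = ⊤
  IsProbAtom (pr≥pr _ _)   = ⊤
  IsProbAtom (pr>pr _ _)   = ⊤
  IsProbAtom _             = ⊥

  -- Every (P-level) occurrence α ⊃ ψ has ψ a probabilistic atom.
  -- (Occurrences of ⊃ inside probabilistic statements or inside
  -- antecedents are CO-level ⊃ᶜ and are unrestricted.)
  Normal : PF → Set
  Normal (lit≐ _ _)     = ⊤
  Normal (lit≠ _ _)     = ⊤
  Normal (pr≥ _ _ _ _)  = ⊤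
  Normal (pr> _ _ _ _)  = ⊤
  Normal (pr≥pr _ _)    = ⊤
  Normal (pr>pr _ _)    = ⊤
  Normal (φ ∧ᵖ ψ)       = Normal φ × Normal ψ
  Normal (φ ⊔ ψ)        = Normal φ × Normal ψ
  Normal (α ⊃ φ)        = IsProbAtom φ

-- Selective implication distributes over ∧ and ⊔, passes unchanged into a
-- probabilistic atom, and nested antecedents merge: α ⊃ (β ⊃ φ) is (α ∧ β) ⊃ φ.
-- The only remaining case is α ⊃ λ for a literal λ, which says that λ holds
-- throughout the sub-multiteam selected by α, i.e. that α → λ holds in every
-- assignment, i.e. Pr(α → λ) ≥ 1.
module Submission where

open import Defs
open import Level using (0ℓ)
open import Function using (_∘_)
open import Function.Bundles using (_⇔_; mk⇔; Equivalence)
open import Function.Construct.Identity using (⇔-id)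
open import Function.Construct.Composition using (_⇔-∘_)
open import Function.Properties.Equivalence using (⇔-setoid)
open import Data.Product using (Σ; _×_; _,_)
open import Data.Product.Function.NonDependent.Propositional using (_×-⇔_)
open import Data.Sum using (inj₁; inj₂)
open import Data.Sum.Function.Propositional using (_⊎-⇔_)
open import Data.Unit using (tt)
open import Data.Empty using (⊥-elim)
open import Data.Bool using (true; false)
import Data.Bool as Bool
open import Data.Bool.Properties using (T-≡)
open import Data.Nat as ℕ using (suc; z≤n)
import Data.Nat.Properties as ℕP
open import Data.Integer as ℤ using (+_)
import Data.Integer.Properties as ℤP
open import Data.Rational as ℚ using (0ℚ; 1ℚ; _/_; toℚᵘ)
import Data.Rational.Properties as ℚP
import Data.Rational.Unnormalised as ℚᵘ
import Data.Rational.Unnormalised.Properties as ℚᵘP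
open import Data.List using ([]; _∷_; filter; length)
open import Data.List.Properties using (length-filter; filter-all; filter-complete)
open import Data.List.Relation.Unary.All as All using (All; []; _∷_)
open import Data.List.Relation.Unary.All.Properties using (all-filter)
open import Relation.Nullary using (yes; no)
open import Relation.Nullary.Decidable using (fromWitness; toWitness)
open import Relation.Unary using (Pred; Decidable)
import Relation.Binary.Reasoning.Setoid as SetoidReasoning
open import Relation.Binary.PropositionalEquality using (_≡_; refl; sym; cong; subst; subst₂)

open Equivalence using (to; from)

module ⇔-Reasoning = SetoidReasoning (⇔-setoid 0ℓ)

module _ {a p} {A : Set a} {P : Pred A p} (P? : Decidable P) where

  All⇔length≤length-filter : ∀ xs → All P xs ⇔ length xs ℕ.≤ length (filter P? xs)
  All⇔length≤length-filter xs = mk⇔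
    (λ all → ℕP.≤-reflexive (sym (cong length (filter-all P? all))))
    (λ len → subst (All P) (filter-complete P? (ℕP.≤-antisym (length-filter P? xs) len))
                   (all-filter P? xs))

  All-filter⇔All-⇒ : ∀ {q} {Q : Pred A q} xs → All Q (filter P? xs) ⇔ All (λ x → P x → Q x) xs
  All-filter⇔All-⇒ [] = mk⇔ (λ _ → []) (λ _ → [])
  All-filter⇔All-⇒ (x ∷ xs) with P? x | All-filter⇔All-⇒ xs
  ... | yes px | ih = mk⇔ (λ { (qx ∷ qxs) → (λ _ → qx) ∷ to ih qxs })
                          (λ { (f ∷ fs) → f px ∷ from ih fs })
  ... | no ¬px | ih = mk⇔ (λ qxs → (λ px → ⊥-elim (¬px px)) ∷ to ih qxs)
                          (λ { (_ ∷ fs) → from ih fs })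

All-cong : ∀ {a p q} {A : Set a} {P : Pred A p} {Q : Pred A q} →
           (∀ x → P x ⇔ Q x) → ∀ xs → All P xs ⇔ All Q xs
All-cong P⇔Q xs = mk⇔ (All.map (to (P⇔Q _))) (All.map (from (P⇔Q _)))

1≤k/[1+m]⇔1+m≤k : ∀ k m → 1ℚ ℚ.≤ + k / suc m ⇔ suc m ℕ.≤ k
1≤k/[1+m]⇔1+m≤k k m = mk⇔
  (λ 1≤k/[1+m] → ℤ.drop‿+≤+ (subst₂ ℤ._≤_ (ℤP.*-identityˡ _) (ℤP.*-identityʳ _)
    (ℚᵘP.drop-*≤* (ℚᵘP.≤-respʳ-≃ k/[1+m]≃ (ℚP.toℚᵘ-mono-≤ 1≤k/[1+m])))))
  (λ 1+m≤k → ℚP.toℚᵘ-cancel-≤ (ℚᵘP.≤-respʳ-≃ (ℚᵘP.≃-sym k/[1+m]≃) (ℚᵘ.*≤*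
    (subst₂ ℤ._≤_ (sym (ℤP.*-identityˡ _)) (sym (ℤP.*-identityʳ _)) (ℤ.+≤+ 1+m≤k)))))
  where
  k/[1+m]≃ : toℚᵘ (+ k / suc m) ℚᵘ.≃ ℚᵘ.mkℚᵘ (+ k) m
  k/[1+m]≃ = ℚP.toℚᵘ-fromℚᵘ (ℚᵘ.mkℚᵘ (+ k) m)

0≤1 : 0ℚ ℚ.≤ 1ℚ
0≤1 = ℚ.*≤* (ℤ.+≤+ z≤n)

module _ (σ : Signature) where

  Holds : CO σ → Pred (Assignment σ) 0ℓ
  Holds γ s = evalCO σ s γ ≡ true

  -- select α is filter (holds? α), definitionally
  holds? : (γ : CO σ) → Decidable (Holds γ)
  holds? γ s = evalCO σ s γ Bool.≟ true

  holds-≐ : ∀ Y (y : Val σ Y) s → s Y ≡ y ⇔ Holds (Y ≐ y) s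
  holds-≐ Y y s = T-≡ ⇔-∘ mk⇔ fromWitness toWitness

  holds-⊃ᶜ : ∀ α γ s → (Holds α s → Holds γ s) ⇔ Holds (α ⊃ᶜ γ) s
  holds-⊃ᶜ α γ s with evalCO σ s α
  ... | true  = mk⇔ (λ f → f refl) (λ h _ → h)
  ... | false = mk⇔ (λ _ → refl) (λ _ ())

  select-∧ᶜ : ∀ α β T → select σ (α ∧ᶜ β) T ≡ select σ β (select σ α T)
  select-∧ᶜ α β [] = refl
  select-∧ᶜ α β (s ∷ T) with evalCO σ s α
  ... | false = select-∧ᶜ α β T
  ... | true with evalCO σ s β
  ...   | true  = cong (s ∷_) (select-∧ᶜ α β T)
  ...   | false = select-∧ᶜ α β T

  All⇔⊨Pr≥1 : ∀ γ T → All (Holds γ) T ⇔ _⊨_ σ T (pr≥ γ 1ℚ 0≤1 ℚP.≤-refl)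
  All⇔⊨Pr≥1 γ [] = mk⇔ (λ _ → inj₁ refl) (λ _ → [])
  All⇔⊨Pr≥1 γ T@(_ ∷ T′) = mk⇔
    (inj₂ ∘ from 1≤Pr⇔ ∘ to (All⇔length≤length-filter (holds? γ) T))
    (λ { (inj₁ ()) ; (inj₂ 1≤Pr) → from (All⇔length≤length-filter (holds? γ) T) (to 1≤Pr⇔ 1≤Pr) })
    where 1≤Pr⇔ = 1≤k/[1+m]⇔1+m≤k (length (select σ γ T)) (length T′)

  ⊨⊃-literal⇔⊨Pr≥1 : ∀ {Q : Pred (Assignment σ) 0ℓ} α γ → (∀ s → Q s ⇔ Holds γ s) → ∀ T →
                      All Q (select σ α T) ⇔ _⊨_ σ T (pr≥ (α ⊃ᶜ γ) 1ℚ 0≤1 ℚP.≤-refl)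
  ⊨⊃-literal⇔⊨Pr≥1 {Q} α γ Q⇔γ T = begin
    All Q (select σ α T)                     ≈⟨ All-cong Q⇔γ (select σ α T) ⟩
    All (Holds γ) (select σ α T)             ≈⟨ All-filter⇔All-⇒ (holds? α) T ⟩
    All (λ s → Holds α s → Holds γ s) T      ≈⟨ All-cong (holds-⊃ᶜ α γ) T ⟩
    All (Holds (α ⊃ᶜ γ)) T                   ≈⟨ All⇔⊨Pr≥1 (α ⊃ᶜ γ) T ⟩
    _⊨_ σ T (pr≥ (α ⊃ᶜ γ) 1ℚ 0≤1 ℚP.≤-refl)  ∎
    where open ⇔-Reasoning

  push⊃ : CO σ → PF σ → PF σ
  push⊃ α (lit≐ Y y)    = pr≥ (α ⊃ᶜ (Y ≐ y)) 1ℚ 0≤1 ℚP.≤-refl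
  push⊃ α (lit≠ Y y)    = pr≥ (α ⊃ᶜ (Y ≠ y)) 1ℚ 0≤1 ℚP.≤-refl
  push⊃ α (φ ∧ᵖ ψ)      = push⊃ α φ ∧ᵖ push⊃ α ψ
  push⊃ α (φ ⊔ ψ)       = push⊃ α φ ⊔ push⊃ α ψ
  push⊃ α (β ⊃ φ)       = push⊃ (α ∧ᶜ β) φ
  push⊃ α φ@(pr≥ _ _ _ _) = α ⊃ φ
  push⊃ α φ@(pr> _ _ _ _) = α ⊃ φ
  push⊃ α φ@(pr≥pr _ _)   = α ⊃ φ
  push⊃ α φ@(pr>pr _ _)   = α ⊃ φ

  push⊃-normal : ∀ α φ → Normal σ (push⊃ α φ)
  push⊃-normal α (lit≐ _ _)    = tt
  push⊃-normal α (lit≠ _ _)    = tt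
  push⊃-normal α (φ ∧ᵖ ψ)      = push⊃-normal α φ , push⊃-normal α ψ
  push⊃-normal α (φ ⊔ ψ)       = push⊃-normal α φ , push⊃-normal α ψ
  push⊃-normal α (β ⊃ φ)       = push⊃-normal (α ∧ᶜ β) φ
  push⊃-normal α (pr≥ _ _ _ _) = tt
  push⊃-normal α (pr> _ _ _ _) = tt
  push⊃-normal α (pr≥pr _ _)   = tt
  push⊃-normal α (pr>pr _ _)   = tt

  ⊨⊃⊃⇔⊨∧ᶜ⊃ : ∀ α β φ T → _⊨_ σ T (α ⊃ (β ⊃ φ)) ⇔ _⊨_ σ T ((α ∧ᶜ β) ⊃ φ)
  ⊨⊃⊃⇔⊨∧ᶜ⊃ α β φ T = mk⇔ (subst (λ U → _⊨_ σ U φ) (sym (select-∧ᶜ α β T)))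
                          (subst (λ U → _⊨_ σ U φ) (select-∧ᶜ α β T))

  push⊃-sound : ∀ α φ T → _⊨_ σ T (α ⊃ φ) ⇔ _⊨_ σ T (push⊃ α φ)
  push⊃-sound α (lit≐ Y y) T    = ⊨⊃-literal⇔⊨Pr≥1 α (Y ≐ y) (holds-≐ Y y) T
  push⊃-sound α (lit≠ Y y) T    = ⊨⊃-literal⇔⊨Pr≥1 α (Y ≠ y) (λ _ → ⇔-id _) T
  push⊃-sound α (φ ∧ᵖ ψ) T      = push⊃-sound α φ T ×-⇔ push⊃-sound α ψ T
  push⊃-sound α (φ ⊔ ψ) T       = push⊃-sound α φ T ⊎-⇔ push⊃-sound α ψ T
  push⊃-sound α (β ⊃ φ) T       = push⊃-sound (α ∧ᶜ β) φ T ⇔-∘ ⊨⊃⊃⇔⊨∧ᶜ⊃ α β φ T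
  push⊃-sound α (pr≥ _ _ _ _) T = ⇔-id _
  push⊃-sound α (pr> _ _ _ _) T = ⇔-id _
  push⊃-sound α (pr≥pr _ _) T   = ⇔-id _
  push⊃-sound α (pr>pr _ _) T   = ⇔-id _

  normalise : PF σ → PF σ
  normalise (φ ∧ᵖ ψ) = normalise φ ∧ᵖ normalise ψ
  normalise (φ ⊔ ψ)  = normalise φ ⊔ normalise ψ
  normalise (α ⊃ φ)  = push⊃ α φ
  normalise φ        = φ

  normalise-normal : ∀ φ → Normal σ (normalise φ)
  normalise-normal (φ ∧ᵖ ψ)      = normalise-normal φ , normalise-normal ψ
  normalise-normal (φ ⊔ ψ)       = normalise-normal φ , normalise-normal ψ
  normalise-normal (α ⊃ φ)       = push⊃-normal α φ
  normalise-normal (lit≐ _ _)    = tt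
  normalise-normal (lit≠ _ _)    = tt
  normalise-normal (pr≥ _ _ _ _) = tt
  normalise-normal (pr> _ _ _ _) = tt
  normalise-normal (pr≥pr _ _)   = tt
  normalise-normal (pr>pr _ _)   = tt

  normalise-sound : ∀ φ T → _⊨_ σ T φ ⇔ _⊨_ σ T (normalise φ)
  normalise-sound (φ ∧ᵖ ψ) T      = normalise-sound φ T ×-⇔ normalise-sound ψ T
  normalise-sound (φ ⊔ ψ) T       = normalise-sound φ T ⊎-⇔ normalise-sound ψ T
  normalise-sound (α ⊃ φ) T       = push⊃-sound α φ T
  normalise-sound (lit≐ _ _) T    = ⇔-id _
  normalise-sound (lit≠ _ _) T    = ⇔-id _
  normalise-sound (pr≥ _ _ _ _) T = ⇔-id _
  normalise-sound (pr> _ _ _ _) T = ⇔-id _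
  normalise-sound (pr≥pr _ _) T   = ⇔-id _
  normalise-sound (pr>pr _ _) T   = ⇔-id _

lemma7 : (σ : Signature) (φ : PF σ) →
    Σ (PF σ) (λ ψ → Normal σ ψ × Equivalent σ φ ψ)
lemma7 σ φ = normalise σ φ , normalise-normal σ φ ,
  λ T → to (normalise-sound σ φ T) , from (normalise-sound σ φ T)
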